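{- There are infinitely many positive integers $n$ such that the open interval $]n, n+n^{1/2}[$ contains no positive integer $m$ with $B(m)=B(m^2)$, where $B(x)$ denotes the number of ones in the binary expansion of $x$.
   Context: For a positive integer $x$, $B(x)$ denotes the sum of the binary digits of $x$ (its Hamming weight). -}

module Defs where

open import Data.Nat using (ℕ; zero; suc; _+_; _*_; _<_; _%_; _/_)

-- Number of ones in the binary expansion, computed with fuel.
-- binWeightAux f x is correct whenever x < 2 ^ f; since x < 2 ^ x,
-- fuel x suffices.
binWeightAux : ℕ → ℕ → ℕ
binWeightAux zero    x = 0
binWeightAux (suc f) x = x % 2 + binWeightAux f (x / 2)

B : ℕ → ℕ
B x = binWeightAux x x

-- m lies in the open real interval ]n, n + n^(1/2)[ :
-- n < m and m - n < sqrt n, i.e. (m - n)^2 < n.  We write d = m - n.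
InOpenInterval : ℕ → ℕ → Set
InOpenInterval n m = n < m × ((m ∸ n) * (m ∸ n) < n)
  where
  open import Data.Product using (_×_)
  open import Data.Nat using (_∸_)

{-# OPTIONS --safe #-}
module Submission where

open import Defs
open import Data.Nat using (ℕ; _≤_; _<_; _*_)
open import Data.Product using (Σ; _×_)
open import Relation.Nullary using (¬_)
open import Relation.Binary.PropositionalEquality using (_≡_)

open import Data.Nat using (zero; suc; _+_; _∸_; _^_; _%_; _/_; z≤n; s≤s; z<s; >-nonZero)
open import Data.Nat.Properties
open import Data.Nat.DivMod
open import Data.Nat.Divisibility using (divides-refl)
open import Data.Nat.Tactic.RingSolver using (solve-∀)
open import Data.Product using (_,_)
open import Relation.Binary.PropositionalEquality
  using (refl; sym; trans; cong; cong₂; subst; module ≡-Reasoning)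
open import Relation.Nullary using (contradiction)

-- Take n = 4^k with k > N.  If n < m < n + √n, then d = m - n satisfies d² < n,
-- hence d < 2^k and 2d < n.  So the binary expansions of m = 2^(2k) + d and
-- m² = (2^(2k) + 2d)·2^(2k) + d² are concatenations of non-overlapping blocks,
-- giving B(m) = 1 + B(d) and B(m²) = 1 + B(d) + B(d²).  Thus B(m) = B(m²)
-- forces B(d²) = 0, i.e. d = 0, which is impossible.

n<2^n : ∀ n → n < 2 ^ n
n<2^n zero    = s≤s z≤n
n<2^n (suc n) = begin-strict
  suc n         <⟨ +-mono-≤ (m^n>0 2 n) (n<2^n n) ⟩
  2 ^ n + 2 ^ n ≡⟨ cong (2 ^ n +_) (sym (+-identityʳ (2 ^ n))) ⟩
  2 ^ suc n     ∎
  where open ≤-Reasoning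

m<2^[1+n]⇒m/2<2^n : ∀ n m → m < 2 ^ suc n → m / 2 < 2 ^ n
m<2^[1+n]⇒m/2<2^n n m m<2^[1+n] = m<n*o⇒m/o<n (subst (m <_) (*-comm 2 (2 ^ n)) m<2^[1+n])

r+q*2<2^[1+n] : ∀ {r q n} → r < 2 → q < 2 ^ n → r + q * 2 < 2 ^ suc n
r+q*2<2^[1+n] {r} {q} {n} r<2 q<2^n = begin-strict
  r + q * 2  <⟨ +-monoˡ-< (q * 2) r<2 ⟩
  suc q * 2  ≤⟨ *-monoˡ-≤ 2 q<2^n ⟩
  2 ^ n * 2  ≡⟨ *-comm (2 ^ n) 2 ⟩
  2 ^ suc n  ∎
  where open ≤-Reasoning

binWeightAux-0 : ∀ f → binWeightAux f 0 ≡ 0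
binWeightAux-0 zero    = refl
binWeightAux-0 (suc f) = binWeightAux-0 f

binWeightAux-+fuel : ∀ f e x → x < 2 ^ f → binWeightAux (f + e) x ≡ binWeightAux f x
binWeightAux-+fuel zero    e zero    _           = binWeightAux-0 e
binWeightAux-+fuel zero    e (suc x) (s≤s ())
binWeightAux-+fuel (suc f) e x       x<2^[1+f]   =
  cong (x % 2 +_) (binWeightAux-+fuel f e (x / 2) (m<2^[1+n]⇒m/2<2^n f x x<2^[1+f]))

binWeightAux-fuel-irrelevant : ∀ f g x → x < 2 ^ f → x < 2 ^ g →
                               binWeightAux f x ≡ binWeightAux g x
binWeightAux-fuel-irrelevant f g x x<2^f x<2^g = begin
  binWeightAux f x       ≡⟨ binWeightAux-+fuel f g x x<2^f ⟨
  binWeightAux (f + g) x ≡⟨ cong (λ h → binWeightAux h x) (+-comm f g) ⟩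
  binWeightAux (g + f) x ≡⟨ binWeightAux-+fuel g f x x<2^g ⟩
  binWeightAux g x       ∎
  where open ≡-Reasoning

B≡binWeightAux : ∀ f x → x < 2 ^ f → B x ≡ binWeightAux f x
B≡binWeightAux f x = binWeightAux-fuel-irrelevant x f x (n<2^n x)

binWeightAux≡0⇒≡0 : ∀ f x → x < 2 ^ f → binWeightAux f x ≡ 0 → x ≡ 0
binWeightAux≡0⇒≡0 zero    zero    _          _  = refl
binWeightAux≡0⇒≡0 zero    (suc x) (s≤s ())   _
binWeightAux≡0⇒≡0 (suc f) x       x<2^[1+f]  eq = begin
  x             ≡⟨ m≡m%n+[m/n]*n x 2 ⟩
  x % 2 + x / 2 * 2
    ≡⟨ cong₂ (λ r q → r + q * 2) (m+n≡0⇒m≡0 (x % 2) eq)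
         (binWeightAux≡0⇒≡0 f (x / 2) (m<2^[1+n]⇒m/2<2^n f x x<2^[1+f]) (m+n≡0⇒n≡0 (x % 2) eq)) ⟩
  0             ∎
  where open ≡-Reasoning

B≡0⇒≡0 : ∀ x → B x ≡ 0 → x ≡ 0
B≡0⇒≡0 x = binWeightAux≡0⇒≡0 x x (n<2^n x)

B[r+q*2]≡r+B[q] : ∀ r q → r < 2 → B (r + q * 2) ≡ r + B q
B[r+q*2]≡r+B[q] r q r<2 = begin
  B x                               ≡⟨ B≡binWeightAux (suc q) x x<2^[1+q] ⟩
  x % 2 + binWeightAux q (x / 2)    ≡⟨ cong₂ (λ r′ q′ → r′ + binWeightAux q q′) x%2≡r x/2≡q ⟩
  r + B q                           ∎
  where
  open ≡-Reasoning
  x = r + q * 2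
  x<2^[1+q] : x < 2 ^ suc q
  x<2^[1+q] = r+q*2<2^[1+n] {n = q} r<2 (n<2^n q)
  x%2≡r : x % 2 ≡ r
  x%2≡r = trans ([m+kn]%n≡m%n r q 2) (m<n⇒m%n≡m r<2)
  x/2≡q : x / 2 ≡ q
  x/2≡q = trans (+-distrib-/-∣ʳ r (divides-refl q)) (cong₂ _+_ (m<n⇒m/n≡0 r<2) (m*n/n≡m q 2))

B≡m%2+B[m/2] : ∀ m → B m ≡ m % 2 + B (m / 2)
B≡m%2+B[m/2] m = trans (cong B (m≡m%n+[m/n]*n m 2)) (B[r+q*2]≡r+B[q] (m % 2) (m / 2) (m%n<n m 2))

B[a*2^j+b]≡B[a]+B[b] : ∀ j a b → b < 2 ^ j → B (a * 2 ^ j + b) ≡ B a + B b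
B[a*2^j+b]≡B[a]+B[b] zero    a zero _ = trans (cong B (trans (+-identityʳ _) (*-identityʳ a)))
                                              (sym (+-identityʳ (B a)))
B[a*2^j+b]≡B[a]+B[b] zero    a (suc b) (s≤s ())
B[a*2^j+b]≡B[a]+B[b] (suc j) a b b<2^[1+j] = begin
  B (a * 2 ^ suc j + b)                ≡⟨ cong B (shift-digit a (2 ^ j) b) ⟩
  B (b % 2 + (a * 2 ^ j + b / 2) * 2)  ≡⟨ B[r+q*2]≡r+B[q] (b % 2) (a * 2 ^ j + b / 2) (m%n<n b 2) ⟩
  b % 2 + B (a * 2 ^ j + b / 2)
    ≡⟨ cong (b % 2 +_) (B[a*2^j+b]≡B[a]+B[b] j a (b / 2) (m<2^[1+n]⇒m/2<2^n j b b<2^[1+j])) ⟩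
  b % 2 + (B a + B (b / 2))            ≡⟨ +-left-comm (b % 2) (B a) _ ⟩
  B a + (b % 2 + B (b / 2))            ≡⟨ cong (B a +_) (B≡m%2+B[m/2] b) ⟨
  B a + B b                            ∎
  where
  open ≡-Reasoning
  +-left-comm : ∀ x y z → x + (y + z) ≡ y + (x + z)
  +-left-comm = solve-∀
  shift-digit : ∀ a p b → a * (2 * p) + b ≡ b % 2 + (a * p + b / 2) * 2
  shift-digit a p b = trans (cong (a * (2 * p) +_) (m≡m%n+[m/n]*n b 2)) (regroup a p (b % 2) (b / 2))
    where
    regroup : ∀ a p r q → a * (2 * p) + (r + q * 2) ≡ r + (a * p + q) * 2
    regroup = solve-∀

B[2^j+b]≡1+B[b] : ∀ j b → b < 2 ^ j → B (2 ^ j + b) ≡ 1 + B b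
B[2^j+b]≡1+B[b] j b b<2^j =
  trans (cong (λ p → B (p + b)) (sym (*-identityˡ (2 ^ j)))) (B[a*2^j+b]≡B[a]+B[b] j 1 b b<2^j)

B[[2^j+b]²]≡B[2^j+b]+B[b²] : ∀ j b → b * 2 < 2 ^ j → b * b < 2 ^ j →
                             B ((2 ^ j + b) * (2 ^ j + b)) ≡ B (2 ^ j + b) + B (b * b)
B[[2^j+b]²]≡B[2^j+b]+B[b²] j b 2b<2^j b²<2^j = begin
  B ((2 ^ j + b) * (2 ^ j + b))      ≡⟨ cong B (square-expansion (2 ^ j) b) ⟩
  B ((2 ^ j + b * 2) * 2 ^ j + b * b) ≡⟨ B[a*2^j+b]≡B[a]+B[b] j (2 ^ j + b * 2) (b * b) b²<2^j ⟩
  B (2 ^ j + b * 2) + B (b * b)       ≡⟨ cong (_+ B (b * b)) (B[2^j+b]≡1+B[b] j (b * 2) 2b<2^j) ⟩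
  1 + B (b * 2) + B (b * b)           ≡⟨ cong (λ w → 1 + w + B (b * b)) (B[r+q*2]≡r+B[q] 0 b z<s) ⟩
  1 + B b + B (b * b)                 ≡⟨ cong (_+ B (b * b)) (B[2^j+b]≡1+B[b] j b b<2^j) ⟨
  B (2 ^ j + b) + B (b * b)           ∎
  where
  open ≡-Reasoning
  b<2^j : b < 2 ^ j
  b<2^j = ≤-<-trans (m≤m*n b 2) 2b<2^j
  square-expansion : ∀ p b → (p + b) * (p + b) ≡ (p + b * 2) * p + b * b
  square-expansion = solve-∀

B[2^j+d]≢B[[2^j+d]²] : ∀ j d → 0 < d → d * 2 < 2 ^ j → d * d < 2 ^ j →
                       ¬ (B (2 ^ j + d) ≡ B ((2 ^ j + d) * (2 ^ j + d)))
B[2^j+d]≢B[[2^j+d]²] j d 0<d 2d<2^j d²<2^j B[m]≡B[m²] = contradiction d≡0 (>⇒≢ 0<d)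
  where
  B[d²]≡0 : B (d * d) ≡ 0
  B[d²]≡0 = sym (+-cancelˡ-≡ (B (2 ^ j + d)) 0 (B (d * d))
              (trans (+-identityʳ _) (trans B[m]≡B[m²] (B[[2^j+b]²]≡B[2^j+b]+B[b²] j d 2d<2^j d²<2^j))))
  d≡0 : d ≡ 0
  d≡0 = m*n≡0⇒m≡0 d d {{>-nonZero 0<d}} (B≡0⇒≡0 (d * d) B[d²]≡0)

m*m<n*n⇒m*2<n*n : ∀ m n → 2 ≤ n → m * m < n * n → m * 2 < n * n
m*m<n*n⇒m*2<n*n m n 2≤n m²<n² = <-≤-trans (*-monoˡ-< 2 m<n) (*-monoʳ-≤ n 2≤n)
  where
  m<n : m < n
  m<n = ≰⇒> (λ n≤m → <⇒≱ m²<n² (*-mono-≤ n≤m n≤m))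

proposition1 : (N : ℕ) → Σ ℕ (λ n → (N ≤ n) × (0 < n) × ((m : ℕ) → 0 < m → InOpenInterval n m → ¬ (B m ≡ B (m * m))))
proposition1 N = n , N≤n , m^n>0 2 (k + k) , no-balanced-m
  where
  k = suc N
  n = 2 ^ (k + k)
  n≡2^k*2^k : n ≡ 2 ^ k * 2 ^ k
  n≡2^k*2^k = ^-distribˡ-+-* 2 k k
  N≤n : N ≤ n
  N≤n = ≤-trans (<⇒≤ (n<2^n N)) (^-monoʳ-≤ 2 (≤-trans (n≤1+n N) (m≤m+n k k)))
  no-balanced-m : (m : ℕ) → 0 < m → InOpenInterval n m → ¬ (B m ≡ B (m * m))
  no-balanced-m m _ (n<m , d²<n) = subst (λ x → ¬ (B x ≡ B (x * x))) (m+[n∸m]≡n (<⇒≤ n<m))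
    (B[2^j+d]≢B[[2^j+d]²] (k + k) d (m<n⇒0<n∸m n<m) 2d<n d²<n)
    where
    d = m ∸ n
    2d<n : d * 2 < n
    2d<n = subst (d * 2 <_) (sym n≡2^k*2^k)
             (m*m<n*n⇒m*2<n*n d (2 ^ k) (*-monoʳ-≤ 2 (m^n>0 2 N)) (subst (d * d <_) n≡2^k*2^k d²<n))
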